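{- Let $\mathbf P=(P,\leq,{}',0,1)$ be an orthogonal lub-complete poset. Then the following conditions are equivalent: (i) $\mathbf P$ is an orthomodular poset; (ii) for all $x,y\in P$: $x\leq y$ if and only if $x\rightarrow_K y=\{1\}$; (iii) for all $x,y\in P$: $x\leq y$ if and only if $x\rightarrow_N y=\{1\}$.
   Context: For a poset $(P,\leq)$ and $A\subseteq P$: $L(A)=\{x\in P: x\leq a\ \forall a\in A\}$, $U(A)=\{x\in P: a\leq x\ \forall a\in A\}$, $L(x,y)=L(\{x,y\})$, $U(x,y)=U(\{x,y\})$. $\operatorname{Max}A$, $\operatorname{Min}A$ denote the sets of maximal, resp. minimal, elements of $A$. $x\vee y$, $x\wedge y$ denote supremum/infimum when they exist. A bounded poset $(P,\leq,{}',0,1)$ with antitone involution satisfies: $x\leq y\Rightarrow y'\leq x'$ and $x''=x$. $x\perp y$ means $x\leq y'$. It is orthogonal if $x\perp y$ implies that $x\vee y$ exists; lub-complete if for every finite $M\subseteq P$ and every lower bound $x$ of $M$ there is a maximal element of $L(M)$ above $x$. An orthomodular poset is an orthogonal poset such that $x\leq y$ implies $x\vee(y\wedge x')=y$ (here $y\wedge x'=(y'\vee x)'$ exists). The Kalmbach implication $\rightarrow_K\colon P^2\to 2^P$ is $x\rightarrow_K y:=\{(a\vee b)\vee(x\wedge c): a\in\operatorname{Max}L(x',y),\ b\in\operatorname{Max}L(x',y'),\ c\in\operatorname{Min}U(x',y)\}$ (in an orthogonal lub-complete poset all these suprema and infima exist), and the non-tolens implication is $x\rightarrow_N y:=y'\rightarrow_K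 x'$. -}

module Defs where

open import Level using (Level; _⊔_; suc)
open import Data.Product using (Σ; ∃; _×_; _,_)
open import Data.List using (List)
open import Data.List.Relation.Unary.All using (All)
open import Relation.Binary.PropositionalEquality using (_≡_)

record BPAI (c ℓ : Level) : Set (suc (c ⊔ ℓ)) where
  field
    Carrier : Set c
    _≤_     : Carrier → Carrier → Set ℓ
    refl≤   : ∀ {x} → x ≤ x
    antisym : ∀ {x y} → x ≤ y → y ≤ x → x ≡ y
    trans≤  : ∀ {x y z} → x ≤ y → y ≤ z → x ≤ z
    _′      : Carrier → Carrier
    𝟘 𝟙     : Carrier
    𝟘-min   : ∀ x → 𝟘 ≤ x
    𝟙-max   : ∀ x → x ≤ 𝟙
    antitone   : ∀ {x y} → x ≤ y → (y ′) ≤ (x ′)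
    involutive : ∀ x → ((x ′) ′) ≡ x

module _ {c ℓ : Level} (P : BPAI c ℓ) where
  open BPAI P

  Subset : Set (suc (c ⊔ ℓ))
  Subset = Carrier → Set (c ⊔ ℓ)

  Lᶠ : List Carrier → Carrier → Set (c ⊔ ℓ)
  Lᶠ M z = All (λ a → z ≤ a) M

  L₂ : Carrier → Carrier → Carrier → Set ℓ
  L₂ x y z = (z ≤ x) × (z ≤ y)

  U₂ : Carrier → Carrier → Carrier → Set ℓ
  U₂ x y z = (x ≤ z) × (y ≤ z)

  IsMax : ∀ {k} → (Carrier → Set k) → Carrier → Set (c ⊔ ℓ ⊔ k)
  IsMax A a = A a × (∀ b → A b → a ≤ b → b ≡ a)

  IsMin : ∀ {k} → (Carrier → Set k) → Carrier → Set (c ⊔ ℓ ⊔ k)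
  IsMin A a = A a × (∀ b → A b → b ≤ a → b ≡ a)

  IsSup : Carrier → Carrier → Carrier → Set (c ⊔ ℓ)
  IsSup x y s = U₂ x y s × (∀ z → U₂ x y z → s ≤ z)

  IsInf : Carrier → Carrier → Carrier → Set (c ⊔ ℓ)
  IsInf x y i = L₂ x y i × (∀ z → L₂ x y z → z ≤ i)

  _⊥_ : Carrier → Carrier → Set ℓ
  x ⊥ y = x ≤ (y ′)

  Orthogonal : Set (c ⊔ ℓ)
  Orthogonal = ∀ x y → x ⊥ y → ∃ λ s → IsSup x y s

  LubComplete : Set (c ⊔ ℓ)
  LubComplete = ∀ (M : List Carrier) x → Lᶠ M x →
                ∃ λ m → IsMax (Lᶠ M) m × (x ≤ m)

  Orthomodular : Set (c ⊔ ℓ)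
  Orthomodular = Orthogonal ×
    (∀ x y → x ≤ y → ∀ m → IsInf y (x ′) m → IsSup x m y)

  -- z ∈ x →K y  iff  z = (a ∨ b) ∨ (x ∧ c) for some
  -- a ∈ Max L(x′,y), b ∈ Max L(x′,y′), c ∈ Min U(x′,y)
  _∈→K_,_ : Carrier → Carrier → Carrier → Set (c ⊔ ℓ)
  z ∈→K x , y = Σ Carrier λ a → Σ Carrier λ b → Σ Carrier λ c' →
    Σ Carrier λ d → Σ Carrier λ e →
      IsMax (L₂ (x ′) y) a × IsMax (L₂ (x ′) (y ′)) b × IsMin (U₂ (x ′) y) c'
      × IsSup a b d × IsInf x c' e × IsSup d e z

  _∈→N_,_ : Carrier → Carrier → Carrier → Set (c ⊔ ℓ)
  z ∈→N x , y = z ∈→K (y ′) , (x ′)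

  IsSingleton𝟙 : (Carrier → Set (c ⊔ ℓ)) → Set (c ⊔ ℓ)
  IsSingleton𝟙 S = S 𝟙 × (∀ z → S z → z ≡ 𝟙)

  CondK : Set (c ⊔ ℓ)
  CondK = ∀ x y → (x ≤ y → IsSingleton𝟙 (λ z → z ∈→K x , y))
                × (IsSingleton𝟙 (λ z → z ∈→K x , y) → x ≤ y)

  CondN : Set (c ⊔ ℓ)
  CondN = ∀ x y → (x ≤ y → IsSingleton𝟙 (λ z → z ∈→N x , y))
                × (IsSingleton𝟙 (λ z → z ∈→N x , y) → x ≤ y)

-- In an orthomodular poset, d ≤ x′, e ≤ x and d ∨ e = 1 force d = x′ and e = x.
-- (i ⇒ ii) If x ≤ y, then x′ ∨ y = 1 and every element of x →K y is
-- ((y ∧ x′) ∨ y′) ∨ x = y ∨ y′ = 1.  If x →K y = {1}, the fact above gives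
-- x′ = a ∨ b for maximal lower bounds a of {x′, y} and b of {x′, y′}, hence
-- x′ ≤ a ∨ y′; orthomodularity writes y = a ∨ (y ∧ a′), so x′ ∨ (y ∧ a′) = 1
-- and the fact again gives x ≤ y ∧ a′ ≤ y.
-- (ii ⇒ i) x →K 1 = {x′ ∨ x} gives x ∨ x′ = 1; for x ≤ y and
-- s = x ∨ (y ∧ x′) one checks y →K s = {1}, whence y ≤ s.
-- (ii ⇔ iii) x →N y is y′ →K x′, and x ≤ y iff y′ ≤ x′.
module Submission where

open import Level using (Level; _⊔_)
open import Data.Product using (_×_; ∃; _,_; proj₁; proj₂)
open import Data.List using ([]; _∷_)
open import Data.List.Relation.Unary.All using ([]; _∷_)
open import Relation.Binary.PropositionalEquality using (_≡_; sym; cong; subst; subst₂)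

open import Defs

module _ {c ℓ : Level} (P : BPAI c ℓ) where
  open BPAI P

  private variable
    a b d e i m p q s t u w x y z : Carrier

  ⊥-sym : x ≤ (y ′) → y ≤ (x ′)
  ⊥-sym {x} {y} h = subst (λ v → v ≤ (x ′)) (involutive y) (antitone h)

  ′≤-swap : (x ′) ≤ y → (y ′) ≤ x
  ′≤-swap {x} {y} h = subst (λ v → (y ′) ≤ v) (involutive x) (antitone h)

  ′-reflects-≤ : (x ′) ≤ (y ′) → y ≤ x
  ′-reflects-≤ {x} {y} h = subst₂ _≤_ (involutive y) (involutive x) (antitone h)

  𝟙′≤𝟘 : (𝟙 ′) ≤ 𝟘
  𝟙′≤𝟘 = ′≤-swap (𝟙-max (𝟘 ′))

  sup⇒inf′ : IsSup P p q s → IsInf P (p ′) (q ′) (s ′)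
  sup⇒inf′ ((p≤s , q≤s) , least) =
    (antitone p≤s , antitone q≤s) ,
    λ w (w≤p′ , w≤q′) → ⊥-sym (least (w ′) (⊥-sym w≤p′ , ⊥-sym w≤q′))

  IsInf-comm : IsInf P p q i → IsInf P q p i
  IsInf-comm ((i≤p , i≤q) , greatest) =
    (i≤q , i≤p) , λ w (w≤q , w≤p) → greatest w (w≤p , w≤q)

  IsInf-≤ˡ : p ≤ q → IsInf P p q p
  IsInf-≤ˡ p≤q = (refl≤ , p≤q) , λ w (w≤p , _) → w≤p

  IsInf-≤ʳ : q ≤ p → IsInf P p q q
  IsInf-≤ʳ q≤p = (q≤p , refl≤) , λ w (_ , w≤q) → w≤q

  IsSup-≤ˡ : p ≤ q → IsSup P p q q
  IsSup-≤ˡ p≤q = (p≤q , refl≤) , λ w (_ , q≤w) → q≤w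

  IsSup-≤ʳ : q ≤ p → IsSup P p q p
  IsSup-≤ʳ q≤p = (refl≤ , q≤p) , λ w (p≤w , _) → p≤w

  IsInf-𝟘 : (∀ w → w ≤ p → w ≤ q → w ≤ 𝟘) → IsInf P p q 𝟘
  IsInf-𝟘 disjoint = (𝟘-min _ , 𝟘-min _) , λ w (w≤p , w≤q) → disjoint w w≤p w≤q

  ≤-IsInf-of-𝟙≤ : IsInf P x u e → 𝟙 ≤ u → x ≤ e
  ≤-IsInf-of-𝟙≤ (_ , greatest) 𝟙≤u = greatest _ (refl≤ , trans≤ (𝟙-max _) 𝟙≤u)

  IsInf⇒IsMax-L₂ : IsInf P p q i → IsMax P (L₂ P p q) i
  IsInf⇒IsMax-L₂ (i-lb , greatest) = i-lb , λ w w-lb i≤w → antisym (greatest w w-lb) i≤w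

  IsInf≡IsMax-L₂ : IsInf P p q i → IsMax P (L₂ P p q) m → i ≡ m
  IsInf≡IsMax-L₂ (i-lb , greatest) (m-lb , maximal) = maximal _ i-lb (greatest _ m-lb)

  IsMin-U₂-𝟙 : (∀ w → U₂ P p q w → 𝟙 ≤ w) → IsMin P (U₂ P p q) 𝟙
  IsMin-U₂-𝟙 above-𝟙 = (𝟙-max _ , 𝟙-max _) , λ w w-ub w≤𝟙 → antisym w≤𝟙 (above-𝟙 w w-ub)

  IsSup-𝟙⇒disjoint : IsSup P d e 𝟙 → w ≤ (d ′) → w ≤ (e ′) → w ≤ 𝟘
  IsSup-𝟙⇒disjoint (_ , least) w≤d′ w≤e′ =
    trans≤ (⊥-sym (least _ (⊥-sym w≤d′ , ⊥-sym w≤e′))) 𝟙′≤𝟘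

  Complemented : Set (c ⊔ ℓ)
  Complemented = ∀ x → IsSup P (x ′) x 𝟙

  complemented⇒disjoint : Complemented → w ≤ p → w ≤ (p ′) → w ≤ 𝟘
  complemented⇒disjoint {p = p} compl w≤p w≤p′ =
    IsSup-𝟙⇒disjoint (compl p) (subst (λ v → _ ≤ v) (sym (involutive p)) w≤p) w≤p′

  OrthomodularLaw : Set (c ⊔ ℓ)
  OrthomodularLaw = ∀ x y → x ≤ y → ∀ m → IsInf P y (x ′) m → IsSup P x m y

  orthomodular⇒complemented : OrthomodularLaw → Complemented
  orthomodular⇒complemented law x =
    let ((x≤𝟙 , x′≤𝟙) , least) = law x 𝟙 (𝟙-max x) (x ′) (IsInf-≤ʳ (𝟙-max (x ′)))
    in (x′≤𝟙 , x≤𝟙) , λ w (x′≤w , x≤w) → least w (x≤w , x′≤w)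

  ∈→K-with-𝟙 : (∀ w → U₂ P (x ′) y w → 𝟙 ≤ w) →
    IsMax P (L₂ P (x ′) y) a → IsMax P (L₂ P (x ′) (y ′)) b →
    IsSup P a b d → IsSup P d x z → _∈→K_,_ P z x y
  ∈→K-with-𝟙 {x = x} above-𝟙 a-max b-max d-sup z-sup =
    _ , _ , 𝟙 , _ , x , a-max , b-max , IsMin-U₂-𝟙 above-𝟙 ,
    d-sup , IsInf-≤ˡ (𝟙-max x) , z-sup

  ∈→K-≡𝟙 :
    (∀ {a b c e} → IsMax P (L₂ P (x ′) y) a → IsMax P (L₂ P (x ′) (y ′)) b →
       IsMin P (U₂ P (x ′) y) c → IsInf P x c e →
       ∀ w → a ≤ w → b ≤ w → e ≤ w → 𝟙 ≤ w) →
    ∀ z → _∈→K_,_ P z x y → z ≡ 𝟙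
  ∈→K-≡𝟙 bound z
    (_ , _ , _ , _ , _ , a-max , b-max , c-min , ((a≤d , b≤d) , _) , e-inf , ((d≤z , e≤z) , _)) =
    antisym (𝟙-max z) (bound a-max b-max c-min e-inf z (trans≤ a≤d d≤z) (trans≤ b≤d d≤z) e≤z)

  CondK⇒CondN : CondK P → CondN P
  CondK⇒CondN K x y =
    let (to , from) = K (y ′) (x ′)
    in (λ x≤y → to (antitone x≤y)) , (λ singleton → ′-reflects-≤ (from singleton))

  CondN⇒CondK : CondN P → CondK P
  CondN⇒CondK N x y =
    let (to , from) = subst₂ (λ p q → ((y ′) ≤ (x ′) → K-singleton p q)
                                      × (K-singleton p q → (y ′) ≤ (x ′)))
                             (involutive x) (involutive y) (N (y ′) (x ′))
    in (λ x≤y → to (antitone x≤y)) , (λ singleton → ′-reflects-≤ (from singleton))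
    where
    K-singleton : Carrier → Carrier → Set (c ⊔ ℓ)
    K-singleton p q = IsSingleton𝟙 P (λ z → _∈→K_,_ P z p q)

  module _ (lub : LubComplete P) where

    maxL-above : L₂ P p q w → ∃ λ m → IsMax P (L₂ P p q) m × (w ≤ m)
    maxL-above {p} {q} {w} (w≤p , w≤q) with lub (p ∷ q ∷ []) w (w≤p ∷ w≤q ∷ [])
    ... | m , ((m≤p ∷ m≤q ∷ []) , maximal) , w≤m =
      m , ((m≤p , m≤q) , λ v (v≤p , v≤q) → maximal v (v≤p ∷ v≤q ∷ [])) , w≤m

    minU-below : U₂ P p q t → ∃ λ u → IsMin P (U₂ P p q) u × (u ≤ t)
    minU-below (p≤t , q≤t) =
      let (m , ((m≤p′ , m≤q′) , maximal) , t′≤m) = maxL-above (antitone p≤t , antitone q≤t)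
      in (m ′) ,
         ((⊥-sym m≤p′ , ⊥-sym m≤q′) ,
          λ v (p≤v , q≤v) v≤m′ →
            subst (λ r → r ≡ m ′) (involutive v)
                  (cong _′ (maximal (v ′) (antitone p≤v , antitone q≤v) (⊥-sym v≤m′)))) ,
         ′≤-swap t′≤m

    ≤-minU⇒𝟙≤-U₂ : Complemented →
      (∀ {u} → IsMin P (U₂ P (x ′) y) u → x ≤ u) → U₂ P (x ′) y t → 𝟙 ≤ t
    ≤-minU⇒𝟙≤-U₂ {x} compl ≤-minU t-ub@(x′≤t , _) =
      let (u , u-min , u≤t) = minU-below t-ub
      in proj₂ (compl x) _ (x′≤t , trans≤ (≤-minU u-min) u≤t)

  module _ (orth : Orthogonal P) where

    inf-exists : (p ′) ≤ q → ∃ (IsInf P p q)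
    inf-exists {p} {q} p′≤q =
      let (s , s-sup) = orth (p ′) (q ′) (subst (λ v → (p ′) ≤ v) (sym (involutive q)) p′≤q)
      in (s ′) , subst₂ (λ u v → IsInf P u v (s ′)) (involutive p) (involutive q) (sup⇒inf′ s-sup)

    ∈→K-of-≤ : Complemented → x ≤ y → IsInf P y (x ′) m →
      ∃ λ z → _∈→K_,_ P z x y × (∀ w → m ≤ w → (y ′) ≤ w → x ≤ w → z ≤ w)
    ∈→K-of-≤ {x} {y} {m} compl x≤y m-inf@((m≤y , m≤x′) , _) =
      let (d , d-sup@(_ , d-least)) = orth m (y ′) (subst (λ v → m ≤ v) (sym (involutive y)) m≤y)
          (z , z-sup@(_ , z-least)) = orth d x (d-least (x ′) (m≤x′ , antitone x≤y))
      in z ,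
         ∈→K-with-𝟙 (λ w (x′≤w , y≤w) → proj₂ (compl x) w (x′≤w , trans≤ x≤y y≤w))
                     (IsInf⇒IsMax-L₂ (IsInf-comm m-inf))
                     (IsInf⇒IsMax-L₂ (IsInf-≤ʳ (antitone x≤y))) d-sup z-sup ,
         λ w m≤w y′≤w x≤w → z-least w (d-least w (m≤w , y′≤w) , x≤w)

    module _ (law : OrthomodularLaw) where

      ≤-of-trivial-relative-complement : e ≤ x → (∀ w → w ≤ x → w ≤ (e ′) → w ≤ 𝟘) → x ≤ e
      ≤-of-trivial-relative-complement {e} {x} e≤x disjoint =
        let (i , i-inf@((i≤x , i≤e′) , _)) = inf-exists (antitone e≤x)
            (_ , least) = law e x e≤x i i-inf
        in least e (refl≤ , trans≤ (disjoint i i≤x i≤e′) (𝟘-min e))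

      IsSup-𝟙⇒complements : IsSup P d e 𝟙 → d ≤ (x ′) → e ≤ x → (x ≤ e) × ((x ′) ≤ d)
      IsSup-𝟙⇒complements d∨e≡𝟙 d≤x′ e≤x =
        ≤-of-trivial-relative-complement e≤x
          (λ w w≤x w≤e′ → IsSup-𝟙⇒disjoint d∨e≡𝟙 (trans≤ w≤x (⊥-sym d≤x′)) w≤e′) ,
        ≤-of-trivial-relative-complement d≤x′
          (λ w w≤x′ w≤d′ → IsSup-𝟙⇒disjoint d∨e≡𝟙 w≤d′ (trans≤ w≤x′ (antitone e≤x)))

      ≤⇒K-singleton : x ≤ y → IsSingleton𝟙 P (λ z → _∈→K_,_ P z x y)
      ≤⇒K-singleton {x} {y} x≤y =
        let compl = orthomodular⇒complemented law
            (m , m-inf) = inf-exists (antitone x≤y)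
            (z , z∈ , _) = ∈→K-of-≤ compl x≤y m-inf
            (_ , y-least) = law x y x≤y m m-inf
            all-𝟙 = ∈→K-≡𝟙 λ a-max b-max ((x′≤c , y≤c) , _) e-inf w a≤w b≤w e≤w →
              let m≤w = subst (λ v → v ≤ w) (sym (IsInf≡IsMax-L₂ (IsInf-comm m-inf) a-max)) a≤w
                  y′≤w = subst (λ v → v ≤ w)
                           (sym (IsInf≡IsMax-L₂ (IsInf-≤ʳ (antitone x≤y)) b-max)) b≤w
                  𝟙≤c = proj₂ (compl x) _ (x′≤c , trans≤ x≤y y≤c)
                  x≤w = trans≤ (≤-IsInf-of-𝟙≤ e-inf 𝟙≤c) e≤w
              in proj₂ (compl y) w (y′≤w , y-least w (x≤w , m≤w))
        in subst (λ v → _∈→K_,_ P v x y) (all-𝟙 z z∈) z∈ , all-𝟙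

      K-singleton⇒complements : IsSingleton𝟙 P (λ z → _∈→K_,_ P z x y) →
        IsMax P (L₂ P (x ′) y) a → IsMax P (L₂ P (x ′) (y ′)) b → IsMin P (U₂ P (x ′) y) u →
        (x ≤ u) × (∀ w → U₂ P a b w → (x ′) ≤ w)
      K-singleton⇒complements {x} (_ , only-𝟙) a-max@((a≤x′ , a≤y) , _) b-max@((b≤x′ , b≤y′) , _)
                              u-min@((x′≤u , _) , _) =
        let (d , d-sup@(_ , d-least)) = orth _ _ (trans≤ a≤y (⊥-sym b≤y′))
            d≤x′ = d-least (x ′) (a≤x′ , b≤x′)
            (e , e-inf@((e≤x , e≤u) , _)) = inf-exists x′≤u
            (z , z-sup) = orth d e (trans≤ d≤x′ (antitone e≤x))
            z≡𝟙 = only-𝟙 z (_ , _ , _ , _ , _ , a-max , b-max , u-min , d-sup , e-inf , z-sup)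
            (x≤e , x′≤d) = IsSup-𝟙⇒complements (subst (IsSup P d e) z≡𝟙 z-sup) d≤x′ e≤x
        in trans≤ x≤e e≤u , λ w w-ub → trans≤ x′≤d (d-least w w-ub)

      K-singleton⇒≤ : LubComplete P → IsSingleton𝟙 P (λ z → _∈→K_,_ P z x y) → x ≤ y
      K-singleton⇒≤ {x} {y} lub S =
        let (a , a-max@((a≤x′ , a≤y) , _) , _) = maxL-above lub (𝟘-min (x ′) , 𝟘-min y)
            (b , b-max@((_ , b≤y′) , _) , _) = maxL-above lub (𝟘-min (x ′) , 𝟘-min (y ′))
            (u , u-min , _) = minU-below lub (𝟙-max (x ′) , 𝟙-max y)
            (v , v-sup@((a≤v , y′≤v) , _)) =
              orth a (y ′) (subst (λ r → a ≤ r) (sym (involutive y)) a≤y)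
            x′≤v = proj₂ (K-singleton⇒complements S a-max b-max u-min) v (a≤v , trans≤ b≤y′ y′≤v)
            v′-inf@((v′≤y , _) , _) = IsInf-comm
              (subst (λ r → IsInf P (a ′) r (v ′)) (involutive y) (sup⇒inf′ v-sup))
            (_ , y-least) = law a y a≤y (v ′) v′-inf
            (t , t-sup@((x′≤t , v′≤t) , _)) =
              orth (x ′) (v ′) (subst (λ r → (x ′) ≤ r) (sym (involutive v)) x′≤v)
            𝟙≤t = ≤-minU⇒𝟙≤-U₂ lub (orthomodular⇒complemented law)
                    (λ u-min → proj₁ (K-singleton⇒complements S a-max b-max u-min))
                    (x′≤t , y-least t (trans≤ a≤x′ x′≤t , v′≤t))
            (x≤v′ , _) = IsSup-𝟙⇒complements (subst (IsSup P (x ′) (v ′)) (antisym (𝟙-max t) 𝟙≤t) t-sup)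
                                             refl≤ (′≤-swap x′≤v)
        in trans≤ x≤v′ v′≤y

    CondK⇒complemented : CondK P → Complemented
    CondK⇒complemented K x =
      let 𝟙′≤x′ = trans≤ 𝟙′≤𝟘 (𝟘-min (x ′))
          (z , z-sup) = orth (x ′) x refl≤
          z∈ = ∈→K-with-𝟙 (λ w (_ , 𝟙≤w) → 𝟙≤w) (IsInf⇒IsMax-L₂ (IsInf-≤ˡ (𝟙-max (x ′))))
                           (IsInf⇒IsMax-L₂ (IsInf-≤ʳ 𝟙′≤x′)) (IsSup-≤ʳ 𝟙′≤x′) z-sup
          (_ , only-𝟙) = proj₁ (K x 𝟙) (𝟙-max x)
      in subst (IsSup P (x ′) x) (only-𝟙 z z∈) z-sup

    CondK⇒orthomodular-law : CondK P → OrthomodularLaw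
    CondK⇒orthomodular-law K x y x≤y m m-inf@((m≤y , m≤x′) , _) =
      let compl = CondK⇒complemented K
          (s , (x≤s , m≤s) , s-least) = orth x m (⊥-sym m≤x′)
          s≤y = s-least y (x≤y , m≤y)
          (z , z∈ , z-least) = ∈→K-of-≤ compl x≤y m-inf
          (_ , only-𝟙) = proj₁ (K x y) x≤y
          y′∨s≡𝟙 : ∀ w → U₂ P (y ′) s w → 𝟙 ≤ w
          y′∨s≡𝟙 w (y′≤w , s≤w) = subst (λ v → v ≤ w) (only-𝟙 z z∈)
            (z-least w (trans≤ m≤s s≤w) y′≤w (trans≤ x≤s s≤w))
          𝟙∈y→Ks = ∈→K-with-𝟙 y′∨s≡𝟙
            (IsInf⇒IsMax-L₂ (IsInf-𝟘 λ w w≤y′ w≤s →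
              complemented⇒disjoint compl (trans≤ w≤s s≤y) w≤y′))
            (IsInf⇒IsMax-L₂ (IsInf-≤ˡ (antitone s≤y))) (IsSup-≤ˡ (𝟘-min (y ′))) (compl y)
          y→Ks-only-𝟙 = ∈→K-≡𝟙 λ _ b-max (c-ub , _) e-inf w _ b≤w e≤w →
            let y′≤w = subst (λ v → v ≤ w)
                         (sym (IsInf≡IsMax-L₂ (IsInf-≤ˡ (antitone s≤y)) b-max)) b≤w
                y≤w = trans≤ (≤-IsInf-of-𝟙≤ e-inf (y′∨s≡𝟙 _ c-ub)) e≤w
            in proj₂ (compl y) w (y′≤w , y≤w)
          y≤s = proj₂ (K y s) (𝟙∈y→Ks , y→Ks-only-𝟙)
      in (x≤y , m≤y) , λ w w-ub → trans≤ y≤s (s-least w w-ub)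

theorem6 : ∀ {c ℓ : Level} (P : BPAI c ℓ) → Orthogonal P → LubComplete P →
    ((Orthomodular P → CondK P) × (CondK P → Orthomodular P))
    × ((Orthomodular P → CondN P) × (CondN P → Orthomodular P))
theorem6 P orth lub =
  (orthomodular⇒CondK , CondK⇒orthomodular) ,
  (λ om → CondK⇒CondN P (orthomodular⇒CondK om)) , (λ N → CondK⇒orthomodular (CondN⇒CondK P N))
  where
  orthomodular⇒CondK : Orthomodular P → CondK P
  orthomodular⇒CondK (_ , law) x y = ≤⇒K-singleton P orth law , K-singleton⇒≤ P orth law lub

  CondK⇒orthomodular : CondK P → Orthomodular P
  CondK⇒orthomodular K = orth , CondK⇒orthomodular-law P orth K
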